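{- Let $\alpha,\beta,c>0$ with $\alpha+2\beta+2c<1/3$. Let $G$ be an oriented graph on $n$ vertices with $\delta^0(G)\ge(1/2-c)n$, and let $V_1,V_2,V_3\subseteq V(G)$ be pairwise disjoint sets such that for every $i\in[3]$: $|V_i|\ge(1/3-\alpha)n$, every $v\in V_i$ satisfies $d^+(v,V_{i+1})\ge|V_{i+1}|-\beta n$, and every $v\in V_i$ satisfies $d^-(v,V_{i-1})\ge|V_{i-1}|-\beta n$ (indices modulo $3$). Then for every $u\in V_1\cup V_2\cup V_3$ and every $i\in[3]$, there is a copy of $D$ in $G$ containing $u$ that has exactly two vertices in $V_i$, one vertex in $V_{i-1}$ and one vertex in $V_{i+1}$.
   Context: An oriented graph is a loopless directed graph with at most one of $uv$, $vu$ per pair of distinct vertices; $\delta^0(G)$ is the minimum of all in- and out-degrees; $d^\pm(v,X)$ is the number of out-/in-neighbours of $v$ in $X$. $D=D_{1,1,2}$ is the tournament on vertices $a,b,c_1,c_2$ with edges $ab,bc_1,bc_2,c_1a,c_2a,c_1c_2$.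
   Formalization: The parameters α, β and c range over the positive rationals. -}

module Defs where

open import Data.Nat using (ℕ; zero; suc)
open import Data.Bool using (Bool; true; false; T)
open import Data.Fin using (Fin; zero; suc)
open import Data.Fin.Subset using (Subset; _∈_; _∩_; ∣_∣)
open import Data.Vec using (tabulate)
open import Data.List using (List; _∷_; []; filter; length)
open import Relation.Nullary using (¬_)
open import Relation.Binary.PropositionalEquality using (_≡_)
open import Data.Fin.Subset.Properties using (_∈?_)

Digraph : ℕ → Set
Digraph n = Fin n → Fin n → Bool

Edge : ∀ {n} → Digraph n → Fin n → Fin n → Set
Edge E u v = T (E u v)

IsOriented : ∀ {n} → Digraph n → Set
IsOriented {n} E = (∀ v → ¬ Edge E v v) × (∀ u v → Edge E u v → ¬ Edge E v u)
  where open import Data.Product using (_×_)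

N⁺ : ∀ {n} → Digraph n → Fin n → Subset n
N⁺ E v = tabulate (λ w → E v w)

N⁻ : ∀ {n} → Digraph n → Fin n → Subset n
N⁻ E v = tabulate (λ w → E w v)

d⁺ : ∀ {n} → Digraph n → Fin n → Subset n → ℕ
d⁺ E v X = ∣ N⁺ E v ∩ X ∣

d⁻ : ∀ {n} → Digraph n → Fin n → Subset n → ℕ
d⁻ E v X = ∣ N⁻ E v ∩ X ∣

outdeg : ∀ {n} → Digraph n → Fin n → ℕ
outdeg E v = ∣ N⁺ E v ∣

indeg : ∀ {n} → Digraph n → Fin n → ℕ
indeg E v = ∣ N⁻ E v ∣

next : Fin 3 → Fin 3
next zero = suc zero
next (suc zero) = suc (suc zero)
next (suc (suc zero)) = zero

prev : Fin 3 → Fin 3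
prev zero = suc (suc zero)
prev (suc zero) = zero
prev (suc (suc zero)) = suc zero

countIn : ∀ {n} → Subset n → List (Fin n) → ℕ
countIn X xs = length (filter (λ x → x ∈? X) xs)

-- Every vertex u of V₁ ∪ V₂ ∪ V₃ lies on a cyclic triangle x → y → z → x with x ∈ V_{i-1},
-- y ∈ V_i and z ∈ V_{i+1}: each part has more than 2βn + 2cn vertices, so two subsets of a
-- part that each miss at most βn of its vertices intersect. Next, the out-neighbourhood of x
-- and the in-neighbourhood of z share more than |V_i| - 2βn vertices of V_i, while
-- N⁺(y) ∪ N⁻(y) has at least (1 - 2c)n vertices because G is oriented; hence some q ∈ V_i
-- with x → q → z is adjacent to y. Ordering y and q along their edge, z, x, y, q span a
-- copy of D with two vertices in V_i.
module Submission where

open import Defs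
open import Data.Bool.Properties using (T-≡)
open import Data.Fin using (Fin; zero; suc)
open import Data.Fin.Subset
  using (Subset; inside; outside; _∈_; _∉_; _⊆_; ∣_∣; Empty; Nonempty; _∩_; _∪_)
open import Data.Fin.Subset.Properties
  using (_∈?_; nonempty?; Empty-unique; ∣⊥∣≡0; ∣⊤∣≡n; ⊆⊤; p⊆q⇒∣p∣≤∣q∣;
         p∩q⊆p; p∩q⊆q; x∈p∩q⁺; x∈p∩q⁻; x∈p∪q⁻)
open import Data.Vec using ([]; _∷_)
open import Data.Vec.Properties using ([]=⇒lookup; lookup∘tabulate)
open import Data.Product using (_×_; _,_; proj₁; proj₂; ∃-syntax; Σ-syntax)
open import Data.Sum using (_⊎_; inj₁; inj₂; [_,_]′)
import Data.Sum
open import Data.List using (List; []; _∷_; length)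
open import Data.List.Properties using (filter-accept; filter-reject)
open import Function using (_∘_; Equivalence)
open import Relation.Nullary using (yes; no; contradiction)
open import Relation.Binary.PropositionalEquality

module Combinatorics where

  open import Data.Nat using (ℕ; suc; _+_; _≤_; _<_)
  import Data.Nat.Properties as ℕ

  ∣p∣+∣q∣≡∣p∪q∣+∣p∩q∣ : ∀ {n} (p q : Subset n) → ∣ p ∣ + ∣ q ∣ ≡ ∣ p ∪ q ∣ + ∣ p ∩ q ∣
  ∣p∣+∣q∣≡∣p∪q∣+∣p∩q∣ []            []            = refl
  ∣p∣+∣q∣≡∣p∪q∣+∣p∩q∣ (inside ∷ p)  (inside ∷ q)  = cong suc (begin
    ∣ p ∣ + suc ∣ q ∣               ≡⟨ ℕ.+-suc ∣ p ∣ ∣ q ∣ ⟩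
    suc (∣ p ∣ + ∣ q ∣)             ≡⟨ cong suc (∣p∣+∣q∣≡∣p∪q∣+∣p∩q∣ p q) ⟩
    suc (∣ p ∪ q ∣ + ∣ p ∩ q ∣)     ≡⟨ ℕ.+-suc ∣ p ∪ q ∣ ∣ p ∩ q ∣ ⟨
    ∣ p ∪ q ∣ + suc ∣ p ∩ q ∣       ∎)
    where open ≡-Reasoning
  ∣p∣+∣q∣≡∣p∪q∣+∣p∩q∣ (inside ∷ p)  (outside ∷ q) = cong suc (∣p∣+∣q∣≡∣p∪q∣+∣p∩q∣ p q)
  ∣p∣+∣q∣≡∣p∪q∣+∣p∩q∣ (outside ∷ p) (inside ∷ q)  =
    trans (ℕ.+-suc ∣ p ∣ ∣ q ∣) (cong suc (∣p∣+∣q∣≡∣p∪q∣+∣p∩q∣ p q))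
  ∣p∣+∣q∣≡∣p∪q∣+∣p∩q∣ (outside ∷ p) (outside ∷ q) = ∣p∣+∣q∣≡∣p∪q∣+∣p∩q∣ p q

  module _ {n : ℕ} where

    ∣p∣+∣q∣≤∣p∩q∣+∣r∣ : {p q r : Subset n} → p ⊆ r → q ⊆ r → ∣ p ∣ + ∣ q ∣ ≤ ∣ p ∩ q ∣ + ∣ r ∣
    ∣p∣+∣q∣≤∣p∩q∣+∣r∣ {p} {q} {r} p⊆r q⊆r = begin
      ∣ p ∣ + ∣ q ∣          ≡⟨ ∣p∣+∣q∣≡∣p∪q∣+∣p∩q∣ p q ⟩
      ∣ p ∪ q ∣ + ∣ p ∩ q ∣  ≤⟨ ℕ.+-monoˡ-≤ ∣ p ∩ q ∣ (p⊆q⇒∣p∣≤∣q∣ p∪q⊆r) ⟩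
      ∣ r ∣ + ∣ p ∩ q ∣      ≡⟨ ℕ.+-comm ∣ r ∣ ∣ p ∩ q ∣ ⟩
      ∣ p ∩ q ∣ + ∣ r ∣      ∎
      where
      open ℕ.≤-Reasoning
      p∪q⊆r : p ∪ q ⊆ r
      p∪q⊆r x∈p∪q = [ p⊆r , q⊆r ]′ (x∈p∪q⁻ p q x∈p∪q)

    ∣p∪q∣≡∣p∣+∣q∣ : {p q : Subset n} → Empty (p ∩ q) → ∣ p ∪ q ∣ ≡ ∣ p ∣ + ∣ q ∣
    ∣p∪q∣≡∣p∣+∣q∣ {p} {q} p∩q≡∅ = sym (begin
      ∣ p ∣ + ∣ q ∣          ≡⟨ ∣p∣+∣q∣≡∣p∪q∣+∣p∩q∣ p q ⟩
      ∣ p ∪ q ∣ + ∣ p ∩ q ∣  ≡⟨ cong (∣ p ∪ q ∣ +_) ∣p∩q∣≡0 ⟩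
      ∣ p ∪ q ∣ + 0          ≡⟨ ℕ.+-identityʳ _ ⟩
      ∣ p ∪ q ∣              ∎)
      where
      open ≡-Reasoning
      ∣p∩q∣≡0 : ∣ p ∩ q ∣ ≡ 0
      ∣p∩q∣≡0 = trans (cong ∣_∣ (Empty-unique p∩q≡∅)) (∣⊥∣≡0 n)

    ∣p∣>0⇒p≢∅ : {p : Subset n} → 0 < ∣ p ∣ → Nonempty p
    ∣p∣>0⇒p≢∅ {p} 0<∣p∣ with nonempty? p
    ... | yes p≢∅ = p≢∅
    ... | no  p≡∅ = contradiction (trans (cong ∣_∣ (Empty-unique p≡∅)) (∣⊥∣≡0 n)) (ℕ.>⇒≢ 0<∣p∣)

    ∣r∣<∣p∣+∣q∣⇒p∩q≢∅ : {p q r : Subset n} → p ⊆ r → q ⊆ r → ∣ r ∣ < ∣ p ∣ + ∣ q ∣ → Nonempty (p ∩ q)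
    ∣r∣<∣p∣+∣q∣⇒p∩q≢∅ {p} {q} {r} p⊆r q⊆r ∣r∣<∣p∣+∣q∣ =
      ∣p∣>0⇒p≢∅ (ℕ.+-cancelʳ-< _ 0 _ (ℕ.<-≤-trans ∣r∣<∣p∣+∣q∣ (∣p∣+∣q∣≤∣p∩q∣+∣r∣ p⊆r q⊆r)))

    n<∣p∣+∣q∣⇒p∩q≢∅ : {p q : Subset n} → n < ∣ p ∣ + ∣ q ∣ → Nonempty (p ∩ q)
    n<∣p∣+∣q∣⇒p∩q≢∅ {p} {q} n<∣p∣+∣q∣ =
      ∣r∣<∣p∣+∣q∣⇒p∩q≢∅ ⊆⊤ ⊆⊤ (subst (_< ∣ p ∣ + ∣ q ∣) (sym (∣⊤∣≡n n)) n<∣p∣+∣q∣)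

    ∉-across : {P Q : Subset n} {v : Fin n} → Empty (P ∩ Q) → v ∈ P → v ∉ Q
    ∉-across P∩Q≡∅ v∈P v∈Q = P∩Q≡∅ (_ , x∈p∩q⁺ (v∈P , v∈Q))

    ∉-across′ : {P Q : Subset n} {v : Fin n} → Empty (P ∩ Q) → v ∈ Q → v ∉ P
    ∉-across′ P∩Q≡∅ v∈Q v∈P = ∉-across P∩Q≡∅ v∈P v∈Q

    ≢-across : {P Q : Subset n} {v w : Fin n} → Empty (P ∩ Q) → v ∈ P → w ∈ Q → v ≢ w
    ≢-across P∩Q≡∅ v∈P w∈Q refl = ∉-across P∩Q≡∅ v∈P w∈Q

    countIn-∷-∈ : {X : Subset n} {v : Fin n} (vs : List (Fin n)) → v ∈ X →
      countIn X (v ∷ vs) ≡ suc (countIn X vs)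
    countIn-∷-∈ {X} _ v∈X = cong length (filter-accept (_∈? X) v∈X)

    countIn-∷-∉ : {X : Subset n} {v : Fin n} (vs : List (Fin n)) → v ∉ X →
      countIn X (v ∷ vs) ≡ countIn X vs
    countIn-∷-∉ {X} _ v∉X = cong length (filter-reject (_∈? X) v∉X)

  module _ {n : ℕ} (E : Digraph n) where

    ∈N⁺⇒Edge : ∀ {v w} → w ∈ N⁺ E v → Edge E v w
    ∈N⁺⇒Edge {v} {w} w∈ =
      Equivalence.from T-≡ (trans (sym (lookup∘tabulate (E v) w)) ([]=⇒lookup w∈))

    ∈N⁻⇒Edge : ∀ {v w} → w ∈ N⁻ E v → Edge E w v
    ∈N⁻⇒Edge {v} {w} w∈ =
      Equivalence.from T-≡ (trans (sym (lookup∘tabulate (λ u → E u v) w)) ([]=⇒lookup w∈))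

    module _ (oriented : IsOriented E) where

      ∣N⁺∪N⁻∣≡outdeg+indeg : ∀ v → ∣ N⁺ E v ∪ N⁻ E v ∣ ≡ outdeg E v + indeg E v
      ∣N⁺∪N⁻∣≡outdeg+indeg v = ∣p∪q∣≡∣p∣+∣q∣ N⁺∩N⁻≡∅
        where
        N⁺∩N⁻≡∅ : Empty (N⁺ E v ∩ N⁻ E v)
        N⁺∩N⁻≡∅ (w , w∈) with x∈p∩q⁻ (N⁺ E v) (N⁻ E v) w∈
        ... | w∈N⁺ , w∈N⁻ = proj₂ oriented v w (∈N⁺⇒Edge w∈N⁺) (∈N⁻⇒Edge w∈N⁻)

      adjacent⇒≢ : ∀ {v w} → Edge E v w ⊎ Edge E w v → v ≢ w
      adjacent⇒≢ {v} (inj₁ vw) refl = proj₁ oriented v vw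
      adjacent⇒≢ {v} (inj₂ wv) refl = proj₁ oriented v wv

  Distinct : ∀ {n} → Fin n → Fin n → Fin n → Fin n → Set
  Distinct a b c₁ c₂ = a ≢ b × a ≢ c₁ × a ≢ c₂ × b ≢ c₁ × b ≢ c₂ × c₁ ≢ c₂

  EdgesOfD : ∀ {n} → Digraph n → Fin n → Fin n → Fin n → Fin n → Set
  EdgesOfD E a b c₁ c₂ = Edge E a b × Edge E b c₁ × Edge E b c₂ × Edge E c₁ a × Edge E c₂ a × Edge E c₁ c₂

  -- Density enters the argument only through these two counting consequences.
  module DenseCycle {n : ℕ} (E : Digraph n) (oriented : IsOriented E)
    (Dense : Subset n → Subset n → Set)
    (dense-pair : ∀ {P X Y} → Dense P X → Dense P Y → ∣ P ∣ < ∣ X ∩ P ∣ + ∣ Y ∩ P ∣)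
    (dense-pair-degree : ∀ {P X Y} → Dense P X → Dense P Y → ∀ v →
      ∣ P ∣ + n < (∣ X ∩ P ∣ + ∣ Y ∩ P ∣) + (outdeg E v + indeg E v))
    where

    _⇉_ : Subset n → Subset n → Set
    P ⇉ Q = (∀ {v} → v ∈ P → Dense Q (N⁺ E v)) × (∀ {w} → w ∈ Q → Dense P (N⁻ E w))

    common-member : ∀ {P X Y} → Dense P X → Dense P Y → ∃[ z ] (z ∈ X × z ∈ Y × z ∈ P)
    common-member {P} {X} {Y} dX dY
      with z , z∈ ← ∣r∣<∣p∣+∣q∣⇒p∩q≢∅ (p∩q⊆q X P) (p∩q⊆q Y P) (dense-pair dX dY)
      with z∈X∩P , z∈Y∩P ← x∈p∩q⁻ (X ∩ P) (Y ∩ P) z∈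
      = z , p∩q⊆p X P z∈X∩P , p∩q⊆p Y P z∈Y∩P , p∩q⊆q X P z∈X∩P

    dense-pair-meets-neighbourhood : ∀ {P X Y} → Dense P X → Dense P Y → ∀ v →
      Nonempty (((X ∩ P) ∩ (Y ∩ P)) ∩ (N⁺ E v ∪ N⁻ E v))
    dense-pair-meets-neighbourhood {P} {X} {Y} dX dY v =
      n<∣p∣+∣q∣⇒p∩q≢∅ (ℕ.+-cancelˡ-< ∣ P ∣ _ _ (begin-strict
      ∣ P ∣ + n
        <⟨ dense-pair-degree dX dY v ⟩
      (∣ X ∩ P ∣ + ∣ Y ∩ P ∣) + (outdeg E v + indeg E v)
        ≤⟨ ℕ.+-mono-≤ (∣p∣+∣q∣≤∣p∩q∣+∣r∣ (p∩q⊆q X P) (p∩q⊆q Y P))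
                      (ℕ.≤-reflexive (sym (∣N⁺∪N⁻∣≡outdeg+indeg E oriented v))) ⟩
      (∣ XY ∣ + ∣ P ∣) + ∣ Nv ∣  ≡⟨ cong (_+ ∣ Nv ∣) (ℕ.+-comm (∣ XY ∣) (∣ P ∣)) ⟩
      (∣ P ∣ + ∣ XY ∣) + ∣ Nv ∣  ≡⟨ ℕ.+-assoc (∣ P ∣) (∣ XY ∣) (∣ Nv ∣) ⟩
      ∣ P ∣ + (∣ XY ∣ + ∣ Nv ∣)  ∎))
      where
      open ℕ.≤-Reasoning
      XY Nv : Subset n
      XY = (X ∩ P) ∩ (Y ∩ P)
      Nv = N⁺ E v ∪ N⁻ E v

    common-member-adjacent-to : ∀ {P X Y} → Dense P X → Dense P Y → ∀ v →
      ∃[ z ] (z ∈ X × z ∈ Y × z ∈ P × (Edge E v z ⊎ Edge E z v))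
    common-member-adjacent-to {P} {X} {Y} dX dY v
      with z , z∈ ← dense-pair-meets-neighbourhood dX dY v
      with z∈XY , z∈Nv ← x∈p∩q⁻ ((X ∩ P) ∩ (Y ∩ P)) (N⁺ E v ∪ N⁻ E v) z∈
      with z∈X∩P , z∈Y∩P ← x∈p∩q⁻ (X ∩ P) (Y ∩ P) z∈XY
      = z , p∩q⊆p X P z∈X∩P , p∩q⊆p Y P z∈Y∩P , p∩q⊆q X P z∈X∩P
          , Data.Sum.map (∈N⁺⇒Edge E) (∈N⁻⇒Edge E) (x∈p∪q⁻ (N⁺ E v) (N⁻ E v) z∈Nv)

    record CyclicTriangle (A B C : Subset n) : Set where
      field
        x y z : Fin n
        x∈A : x ∈ A
        y∈B : y ∈ B
        z∈C : z ∈ C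
        x→y : Edge E x y
        y→z : Edge E y z
        z→x : Edge E z x

    _∈▵_ : ∀ {A B C} → Fin n → CyclicTriangle A B C → Set
    u ∈▵ t = u ≡ x ⊎ u ≡ y ⊎ u ≡ z
      where open CyclicTriangle t

    CyclicTriangleThrough : Subset n → Subset n → Subset n → Fin n → Set
    CyclicTriangleThrough A B C u = Σ[ t ∈ CyclicTriangle A B C ] u ∈▵ t

    rotate : ∀ {A B C u} → CyclicTriangleThrough A B C u → CyclicTriangleThrough C A B u
    rotate (t , u∈t) = record
      { x = z ; y = x ; z = y ; x∈A = z∈C ; y∈B = x∈A ; z∈C = y∈B
      ; x→y = z→x ; y→z = x→y ; z→x = y→z
      } , [ inj₂ ∘ inj₁ , [ inj₂ ∘ inj₂ , inj₁ ]′ ]′ u∈t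
      where open CyclicTriangle t

    triangle-at : ∀ {A B C u} → A ⇉ B → B ⇉ C → C ⇉ A → u ∈ A → CyclicTriangleThrough A B C u
    triangle-at {u = u} (A⁺ , _) (B⁺ , _) (_ , A⁻) u∈A
      with y , y∈N⁺u , _ , y∈B ← common-member (A⁺ u∈A) (A⁺ u∈A)
      with z , z∈N⁺y , z∈N⁻u , z∈C ← common-member (B⁺ y∈B) (A⁻ u∈A)
      = record
      { x = u ; y = y ; z = z ; x∈A = u∈A ; y∈B = y∈B ; z∈C = z∈C
      ; x→y = ∈N⁺⇒Edge E y∈N⁺u ; y→z = ∈N⁺⇒Edge E z∈N⁺y ; z→x = ∈N⁻⇒Edge E z∈N⁻u
      } , inj₁ refl

    triangle-through : ∀ {A B C u} → A ⇉ B → B ⇉ C → C ⇉ A →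
      u ∈ A ⊎ u ∈ B ⊎ u ∈ C → CyclicTriangleThrough A B C u
    triangle-through A⇉B B⇉C C⇉A (inj₁ u∈A)        = triangle-at A⇉B B⇉C C⇉A u∈A
    triangle-through A⇉B B⇉C C⇉A (inj₂ (inj₁ u∈B)) = rotate (triangle-at B⇉C C⇉A A⇉B u∈B)
    triangle-through A⇉B B⇉C C⇉A (inj₂ (inj₂ u∈C)) = rotate (rotate (triangle-at C⇉A A⇉B B⇉C u∈C))

    module _ {A B C : Subset n}
      (A∩B≡∅ : Empty (A ∩ B)) (B∩C≡∅ : Empty (B ∩ C)) (C∩A≡∅ : Empty (C ∩ A))
      (A⇉B : A ⇉ B) (B⇉C : B ⇉ C) (C⇉A : C ⇉ A)
      where

      Balanced : Fin n → Fin n → Fin n → Fin n → Set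
      Balanced a b c₁ c₂ =
        countIn B (a ∷ b ∷ c₁ ∷ c₂ ∷ []) ≡ 2
        × countIn A (a ∷ b ∷ c₁ ∷ c₂ ∷ []) ≡ 1
        × countIn C (a ∷ b ∷ c₁ ∷ c₂ ∷ []) ≡ 1

      CopyOfDThrough : Fin n → Set
      CopyOfDThrough u = ∃[ a ] ∃[ b ] ∃[ c₁ ] ∃[ c₂ ]
        (Distinct a b c₁ c₂ × EdgesOfD E a b c₁ c₂ × (u ≡ a ⊎ u ≡ b ⊎ u ≡ c₁ ⊎ u ≡ c₂) × Balanced a b c₁ c₂)

      balanced : ∀ {z x y y′} → z ∈ C → x ∈ A → y ∈ B → y′ ∈ B → Balanced z x y y′
      balanced z∈C x∈A y∈B y′∈B =
          trans (countIn-∷-∉ _ (∉-across′ B∩C≡∅ z∈C)) (trans (countIn-∷-∉ _ (∉-across A∩B≡∅ x∈A))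
            (trans (countIn-∷-∈ _ y∈B) (cong suc (countIn-∷-∈ _ y′∈B))))
        , trans (countIn-∷-∉ _ (∉-across C∩A≡∅ z∈C)) (trans (countIn-∷-∈ _ x∈A)
            (cong suc (trans (countIn-∷-∉ _ (∉-across′ A∩B≡∅ y∈B)) (countIn-∷-∉ _ (∉-across′ A∩B≡∅ y′∈B)))))
        , trans (countIn-∷-∈ _ z∈C) (cong suc (trans (countIn-∷-∉ _ (∉-across′ C∩A≡∅ x∈A))
            (trans (countIn-∷-∉ _ (∉-across B∩C≡∅ y∈B)) (countIn-∷-∉ _ (∉-across B∩C≡∅ y′∈B)))))

      copy-of-D : ∀ {z x y y′} → z ∈ C → x ∈ A → y ∈ B → y′ ∈ B → y ≢ y′ →
        Edge E z x → Edge E x y → Edge E x y′ → Edge E y z → Edge E y′ z → Edge E y y′ →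
        Distinct z x y y′ × EdgesOfD E z x y y′ × Balanced z x y y′
      copy-of-D z∈C x∈A y∈B y′∈B y≢y′ zx xy xy′ yz y′z yy′ =
          ( ≢-across C∩A≡∅ z∈C x∈A , ≢-sym (≢-across B∩C≡∅ y∈B z∈C) , ≢-sym (≢-across B∩C≡∅ y′∈B z∈C)
          , ≢-across A∩B≡∅ x∈A y∈B , ≢-across A∩B≡∅ x∈A y′∈B , y≢y′ )
        , (zx , xy , xy′ , yz , y′z , yy′)
        , balanced z∈C x∈A y∈B y′∈B

      ∈▵⇒∈D : ∀ {u x y z c₁ c₂ : Fin n} → (u ≡ y → u ≡ c₁ ⊎ u ≡ c₂) →
        u ≡ x ⊎ u ≡ y ⊎ u ≡ z → u ≡ z ⊎ u ≡ x ⊎ u ≡ c₁ ⊎ u ≡ c₂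
      ∈▵⇒∈D _    (inj₁ u≡x)        = inj₂ (inj₁ u≡x)
      ∈▵⇒∈D at-y (inj₂ (inj₁ u≡y)) = inj₂ (inj₂ (at-y u≡y))
      ∈▵⇒∈D _    (inj₂ (inj₂ u≡z)) = inj₁ u≡z

      module _ (t : CyclicTriangle A B C) where
        open CyclicTriangle t

        copy-of-D-on : ∀ {u} → u ∈▵ t → CopyOfDThrough u
        copy-of-D-on u∈t with common-member-adjacent-to (proj₁ A⇉B x∈A) (proj₂ B⇉C z∈C) y
        ... | q , q∈N⁺x , q∈N⁻z , q∈B , inj₁ y→q
          with distinct , edges , bal ← copy-of-D z∈C x∈A y∈B q∈B (adjacent⇒≢ E oriented (inj₁ y→q))
                          z→x x→y (∈N⁺⇒Edge E q∈N⁺x) y→z (∈N⁻⇒Edge E q∈N⁻z) y→q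
          = z , x , y , q , distinct , edges , ∈▵⇒∈D inj₁ u∈t , bal
        ... | q , q∈N⁺x , q∈N⁻z , q∈B , inj₂ q→y
          with distinct , edges , bal ← copy-of-D z∈C x∈A q∈B y∈B (adjacent⇒≢ E oriented (inj₁ q→y))
                          z→x (∈N⁺⇒Edge E q∈N⁺x) x→y (∈N⁻⇒Edge E q∈N⁻z) y→z q→y
          = z , x , q , y , distinct , edges , ∈▵⇒∈D inj₂ u∈t , bal

      copy-of-D-through : ∀ {u} → u ∈ A ⊎ u ∈ B ⊎ u ∈ C → CopyOfDThrough u
      copy-of-D-through u∈ABC with t , u∈t ← triangle-through A⇉B B⇉C C⇉A u∈ABC = copy-of-D-on t u∈t

open import Data.Nat using (ℕ; zero; suc)
import Data.Nat as ℕ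
import Data.Nat.Properties as ℕ
open import Data.Integer using (+_)
import Data.Integer.Properties as ℤ
open import Data.Nat.Coprimality using (1-coprimeTo)
import Data.Nat.Coprimality as Coprime
open import Data.Rational
  using (ℚ; mkℚ; *<*; _<_; _≤_; _+_; _-_; _*_; _/_; 0ℚ; ½; positive; nonNegative)
import Data.Rational.Properties as ℚ
open import Data.Rational.Solver using (module +-*-Solver)

open Combinatorics using (module DenseCycle)

next∘prev : ∀ i → next (prev i) ≡ i
next∘prev zero             = refl
next∘prev (suc zero)       = refl
next∘prev (suc (suc zero)) = refl

prev∘next : ∀ i → prev (next i) ≡ i
prev∘next zero             = refl
prev∘next (suc zero)       = refl
prev∘next (suc (suc zero)) = refl

next∘next : ∀ i → next (next i) ≡ prev i
next∘next zero             = refl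
next∘next (suc zero)       = refl
next∘next (suc (suc zero)) = refl

prev≢id : ∀ i → prev i ≢ i
prev≢id zero             ()
prev≢id (suc zero)       ()
prev≢id (suc (suc zero)) ()

id≢next : ∀ i → i ≢ next i
id≢next zero             ()
id≢next (suc zero)       ()
id≢next (suc (suc zero)) ()

next≢prev : ∀ i → next i ≢ prev i
next≢prev zero             ()
next≢prev (suc zero)       ()
next≢prev (suc (suc zero)) ()

prev⊎id⊎next : ∀ {ℓ} (P : Fin 3 → Set ℓ) i {j} → P j → P (prev i) ⊎ P i ⊎ P (next i)
prev⊎id⊎next P zero             {zero}             p = inj₂ (inj₁ p)
prev⊎id⊎next P zero             {suc zero}         p = inj₂ (inj₂ p)
prev⊎id⊎next P zero             {suc (suc zero)}   p = inj₁ p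
prev⊎id⊎next P (suc zero)       {zero}             p = inj₁ p
prev⊎id⊎next P (suc zero)       {suc zero}         p = inj₂ (inj₁ p)
prev⊎id⊎next P (suc zero)       {suc (suc zero)}   p = inj₂ (inj₂ p)
prev⊎id⊎next P (suc (suc zero)) {zero}             p = inj₂ (inj₂ p)
prev⊎id⊎next P (suc (suc zero)) {suc zero}         p = inj₁ p
prev⊎id⊎next P (suc (suc zero)) {suc (suc zero)}   p = inj₂ (inj₁ p)

ι : ℕ → ℚ
ι k = + k / 1

ι≡mkℚ : ∀ k → ι k ≡ mkℚ (+ k) 0 (Coprime.sym (1-coprimeTo k))
ι≡mkℚ k = ℚ.↥p/↧p≡p (mkℚ (+ k) 0 (Coprime.sym (1-coprimeTo k)))

ι-+ : ∀ a b → ι a + ι b ≡ ι (a ℕ.+ b)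
ι-+ a b rewrite ι≡mkℚ a | ι≡mkℚ b | ℕ.*-identityʳ a | ℕ.*-identityʳ b | ℤ.+◃n≡+n a | ℤ.+◃n≡+n b = refl

ι-cancel-< : ∀ {a b} → ι a < ι b → a ℕ.< b
ι-cancel-< {a} {b} ιa<ιb rewrite ι≡mkℚ a | ι≡mkℚ b with ιa<ιb
... | *<* a*1<b*1 rewrite ℤ.*-identityʳ (+ a) | ℤ.*-identityʳ (+ b) = ℤ.drop‿+<+ a*1<b*1

ι-mono-+ : ∀ {p q} a b → p ≤ ι a → q ≤ ι b → p + q ≤ ι (a ℕ.+ b)
ι-mono-+ a b p≤ιa q≤ιb = subst (_ ≤_) (ι-+ a b) (ℚ.+-mono-≤ p≤ιa q≤ιb)

p<q⇒0<q-p : ∀ {p q} → p < q → 0ℚ < q - p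
p<q⇒0<q-p {p} {q} p<q = subst (_< q - p) (ℚ.+-inverseʳ p) (ℚ.+-monoˡ-< (Data.Rational.- p) p<q)

<-by-gap : ∀ {p q} d → 0ℚ < d → p + d ≡ q → p < q
<-by-gap {p} d 0<d p+d≡q = subst₂ _<_ (ℚ.+-identityʳ p) p+d≡q (ℚ.+-monoʳ-< p 0<d)

open +-*-Solver

size⇒large : ∀ α β c {N s} → 0ℚ < N → α + (+ 2 / 1) * β + (+ 2 / 1) * c < + 1 / 3 →
  (+ 1 / 3 - α) * N ≤ s → β * N + β * N + (c * N + c * N) < s
size⇒large α β c {N} 0<N sum<⅓ ⅓-α≤s = ℚ.<-≤-trans (<-by-gap gap 0<gap gap-identity) ⅓-α≤s
  where
  gap : ℚ
  gap = (+ 1 / 3 - (α + (+ 2 / 1) * β + (+ 2 / 1) * c)) * N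
  0<gap : 0ℚ < gap
  0<gap = subst (_< gap) (ℚ.*-zeroˡ N) (ℚ.*-monoˡ-<-pos N {{positive 0<N}} (p<q⇒0<q-p sum<⅓))
  gap-identity : β * N + β * N + (c * N + c * N) + gap ≡ (+ 1 / 3 - α) * N
  gap-identity = solve 4 (λ α β c N →
      β :* N :+ β :* N :+ (c :* N :+ c :* N)
        :+ (con (+ 1 / 3) :- (α :+ con (+ 2 / 1) :* β :+ con (+ 2 / 1) :* c)) :* N
      := (con (+ 1 / 3) :- α) :* N) refl α β c N

two-robust-sets-exceed : ∀ {s B C} → 0ℚ ≤ C → B + B + (C + C) < s → s < (s - B) + (s - B)
two-robust-sets-exceed {s} {B} {C} 0≤C large = <-by-gap gap 0<gap gap-identity
  where
  gap : ℚ
  gap = (s - (B + B + (C + C))) + (C + C)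
  0<gap : 0ℚ < gap
  0<gap = ℚ.+-mono-<-≤ (p<q⇒0<q-p large) (ℚ.+-mono-≤ 0≤C 0≤C)
  gap-identity : s + gap ≡ (s - B) + (s - B)
  gap-identity = solve 3 (λ s B C →
      s :+ ((s :- (B :+ B :+ (C :+ C))) :+ (C :+ C)) := (s :- B) :+ (s :- B)) refl s B C

two-robust-sets-and-degrees-exceed : ∀ {s B c N} → B + B + (c * N + c * N) < s →
  s + N < ((s - B) + (s - B)) + ((½ - c) * N + (½ - c) * N)
two-robust-sets-and-degrees-exceed {s} {B} {c} {N} large = <-by-gap _ (p<q⇒0<q-p large) gap-identity
  where
  gap-identity : s + N + (s - (B + B + (c * N + c * N)))
               ≡ ((s - B) + (s - B)) + ((½ - c) * N + (½ - c) * N)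
  gap-identity = solve 4 (λ s B c N →
      s :+ N :+ (s :- (B :+ B :+ (c :* N :+ c :* N)))
        := ((s :- B) :+ (s :- B)) :+ ((con ½ :- c) :* N :+ (con ½ :- c) :* N)) refl s B c N

-- X misses at most βn vertices of P; `large` is what forces two such sets, or two such sets
-- and a set N⁺(v) ∪ N⁻(v) of at least (1 - 2c)n vertices, to meet inside P.
record Dense (β c : ℚ) {n : ℕ} (P X : Subset n) : Set where
  field
    large  : β * ι n + β * ι n + (c * ι n + c * ι n) < ι ∣ P ∣
    robust : ι ∣ P ∣ - β * ι n ≤ ι ∣ X ∩ P ∣
open Dense

robust-sum : ∀ {β c n} {P X Y : Subset n} → Dense β c P X → Dense β c P Y →
  (ι ∣ P ∣ - β * ι n) + (ι ∣ P ∣ - β * ι n) ≤ ι (∣ X ∩ P ∣ ℕ.+ ∣ Y ∩ P ∣)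
robust-sum {P = P} {X} {Y} dX dY = ι-mono-+ (∣ X ∩ P ∣) (∣ Y ∩ P ∣) (robust dX) (robust dY)

dense-pair : ∀ {β c n} → 0ℚ ≤ c → {P X Y : Subset n} → Dense β c P X → Dense β c P Y →
  ∣ P ∣ ℕ.< ∣ X ∩ P ∣ ℕ.+ ∣ Y ∩ P ∣
dense-pair {c = c} {n} 0≤c {P} {X} {Y} dX dY =
  ι-cancel-< (ℚ.<-≤-trans (two-robust-sets-exceed 0≤c*n (large dX)) (robust-sum dX dY))
  where
  0≤c*n : 0ℚ ≤ c * ι n
  0≤c*n = ℚ.nonNegative⁻¹ _
    {{ℚ.nonNeg*nonNeg⇒nonNeg c {{nonNegative 0≤c}} (ι n) {{ℚ.normalize-nonNeg n 1}}}}

dense-pair-degree : ∀ {β c n} (E : Digraph n) →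
  (∀ v → (½ - c) * ι n ≤ ι (outdeg E v)) → (∀ v → (½ - c) * ι n ≤ ι (indeg E v)) →
  {P X Y : Subset n} → Dense β c P X → Dense β c P Y → ∀ v →
  ∣ P ∣ ℕ.+ n ℕ.< (∣ X ∩ P ∣ ℕ.+ ∣ Y ∩ P ∣) ℕ.+ (outdeg E v ℕ.+ indeg E v)
dense-pair-degree {β} {c} {n} E δ⁺ δ⁻ {P} {X} {Y} dX dY v = ι-cancel-< (begin-strict
  ι (∣ P ∣ ℕ.+ n)              ≡⟨ ι-+ ∣ P ∣ n ⟨
  ι ∣ P ∣ + ι n                <⟨ two-robust-sets-and-degrees-exceed {c = c} (large dX) ⟩
  ((s - B) + (s - B)) + (h + h) ≤⟨ ι-mono-+ (∣ X ∩ P ∣ ℕ.+ ∣ Y ∩ P ∣) (outdeg E v ℕ.+ indeg E v)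
                                     (robust-sum dX dY) (ι-mono-+ (outdeg E v) (indeg E v) (δ⁺ v) (δ⁻ v)) ⟩
  ι ((∣ X ∩ P ∣ ℕ.+ ∣ Y ∩ P ∣) ℕ.+ (outdeg E v ℕ.+ indeg E v)) ∎)
  where
  open ℚ.≤-Reasoning
  s B h : ℚ
  s = ι ∣ P ∣
  B = β * ι n
  h = (½ - c) * ι n

lemma5p22 : (α β c : ℚ) → 0ℚ < α → 0ℚ < β → 0ℚ < c →
    α + (+ 2 / 1) * β + (+ 2 / 1) * c < + 1 / 3 →
    (n : ℕ) (E : Digraph n) → IsOriented E →
    (∀ v → (½ - c) * (+ n / 1) ≤ + (outdeg E v) / 1) →
    (∀ v → (½ - c) * (+ n / 1) ≤ + (indeg E v) / 1) →
    (V : Fin 3 → Subset n) →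
    (∀ i j → i ≢ j → Empty (V i ∩ V j)) →
    (∀ i → (+ 1 / 3 - α) * (+ n / 1) ≤ + ∣ V i ∣ / 1) →
    (∀ i v → v ∈ V i →
      + ∣ V (next i) ∣ / 1 - β * (+ n / 1) ≤ + (d⁺ E v (V (next i))) / 1) →
    (∀ i v → v ∈ V i →
      + ∣ V (prev i) ∣ / 1 - β * (+ n / 1) ≤ + (d⁻ E v (V (prev i))) / 1) →
    (u : Fin n) → (∃[ j ] u ∈ V j) → (i : Fin 3) →
    ∃[ a ] ∃[ b ] ∃[ c₁ ] ∃[ c₂ ]
      ( (a ≢ b × a ≢ c₁ × a ≢ c₂ × b ≢ c₁ × b ≢ c₂ × c₁ ≢ c₂)
      × (Edge E a b × Edge E b c₁ × Edge E b c₂ × Edge E c₁ a × Edge E c₂ a × Edge E c₁ c₂)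
      × (u ≡ a ⊎ u ≡ b ⊎ u ≡ c₁ ⊎ u ≡ c₂)
      × countIn (V i) (a ∷ b ∷ c₁ ∷ c₂ ∷ []) ≡ 2
      × countIn (V (prev i)) (a ∷ b ∷ c₁ ∷ c₂ ∷ []) ≡ 1
      × countIn (V (next i)) (a ∷ b ∷ c₁ ∷ c₂ ∷ []) ≡ 1 )
lemma5p22 _ _ _ _ _ _ _ zero _ _ _ _ _ _ _ _ _ () _ _
lemma5p22 α β c _ _ 0<c sum<⅓ n@(suc _) E oriented δ⁺ δ⁻ V disjoint size out-robust in-robust
  u (j , u∈Vj) i = copy-of-D-through
    (disjoint (prev i) i (prev≢id i)) (disjoint i (next i) (id≢next i)) (disjoint (next i) (prev i) (next≢prev i))
    (⇉-to (next∘prev i)) (⇉-to refl) (⇉-to (next∘next i))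
    (prev⊎id⊎next (λ k → u ∈ V k) i u∈Vj)
  where
  open DenseCycle E oriented (Dense β c) (dense-pair (ℚ.<⇒≤ 0<c)) (dense-pair-degree E δ⁺ δ⁻)
  large-parts : ∀ k → β * ι n + β * ι n + (c * ι n + c * ι n) < ι ∣ V k ∣
  large-parts k = size⇒large α β c (ℚ.positive⁻¹ _ {{ℚ.normalize-pos n 1}}) sum<⅓ (size k)
  ⇉-next : ∀ k → V k ⇉ V (next k)
  ⇉-next k = (λ v∈Vk → record { large = large-parts (next k) ; robust = out-robust k _ v∈Vk })
           , (λ {w} w∈Vk⁺ → subst (λ l → Dense β c (V l) (N⁻ E w)) (prev∘next k)
                 (record { large = large-parts (prev (next k)) ; robust = in-robust (next k) w w∈Vk⁺ }))
  ⇉-to : ∀ {k l} → next k ≡ l → V k ⇉ V l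
  ⇉-to refl = ⇉-next _
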